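{- Suppose the Gaussian Goldbach conjecture holds: every even Gaussian integer $z=a+ib$ with integers $a>1$, $b>1$ is a sum of two Gaussian primes lying in $Q=\{x+iy: x>0,\ y>0\}$. Then every Gaussian integer $a+ib$ with integers $a>2$, $b>2$ is a sum of three Gaussian primes lying in $Q$.
   Context: A Gaussian integer $a+ib$ is called even if $a+b$ is even. A Gaussian prime is an irreducible element of $\mathbb{Z}[i]$; the summands need not be distinct. -}

module Defs where

open import Data.Integer using (ℤ; +_; _+_; _-_; _*_; _>_)
open import Data.Product using (_×_; _,_; ∃; ∃-syntax)
open import Data.Sum using (_⊎_)
open import Relation.Nullary using (¬_)
open import Relation.Binary.PropositionalEquality using (_≡_)

record ℤ[i] : Set where
  constructor _+i_
  field
    re : ℤ
    im : ℤ
open ℤ[i] public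

infixl 6 _⊕_
infixl 7 _⊗_

_⊕_ : ℤ[i] → ℤ[i] → ℤ[i]
(a +i b) ⊕ (c +i d) = (a + c) +i (b + d)

_⊗_ : ℤ[i] → ℤ[i] → ℤ[i]
(a +i b) ⊗ (c +i d) = (a * c - b * d) +i (a * d + b * c)

0ᵍ : ℤ[i]
0ᵍ = (+ 0) +i (+ 0)

1ᵍ : ℤ[i]
1ᵍ = (+ 1) +i (+ 0)

IsUnit : ℤ[i] → Set
IsUnit u = ∃[ w ] (u ⊗ w ≡ 1ᵍ)

IsGaussianPrime : ℤ[i] → Set
IsGaussianPrime p =
  ¬ (p ≡ 0ᵍ) × ¬ IsUnit p ×
  (∀ x y → p ≡ x ⊗ y → IsUnit x ⊎ IsUnit y)

IsEven : ℤ[i] → Set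
IsEven z = ∃[ k ] (re z + im z ≡ (+ 2) * k)

InQ : ℤ[i] → Set
InQ z = (re z > + 0) × (im z > + 0)

QPrime : ℤ[i] → Set
QPrime p = IsGaussianPrime p × InQ p

GaussianGoldbach : Set
GaussianGoldbach =
  ∀ (a b : ℤ) → a > + 1 → b > + 1 → IsEven (a +i b) →
  ∃[ p ] ∃[ q ] (QPrime p × QPrime q × (a +i b) ≡ p ⊕ q)

module Submission where

-- Split off one small prime c
-- in Q so that the rest, (a +i b) - c, is even with both coordinates at
-- least 2; the Goldbach hypothesis writes the rest as a sum of two primes
-- in Q.  The choice of c depends on the parity of a + b:
--   * a + b even:            c = 1 + i   (norm 2),
--   * a + b odd and a ≥ 4:   c = 2 + i   (norm 5),
--   * a + b odd and a = 3:   c = 1 + 2i  (norm 5; then b is even, so b ≥ 4).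
-- To know that these c are Gaussian primes we use the norm
-- N(x + iy) = x² + y²: it is multiplicative, units are exactly the elements
-- of norm 1, and hence every Gaussian integer of rational prime norm is
-- irreducible.

open import Defs
open import Data.Integer using (ℤ; +_; _>_)
open import Data.Product using (_×_; _,_; ∃-syntax)
open import Relation.Binary.PropositionalEquality using (_≡_)

open import Data.Integer as ℤ using (-[1+_]; -_; ∣_∣; +<+)
import Data.Integer.Properties as ℤP
open import Data.Integer.Tactic.RingSolver as ℤSolver using ()
open import Data.Nat as ℕ using (ℕ; zero; suc; s≤s; z≤n)
import Data.Nat.Properties as ℕP
open import Data.Nat.Tactic.RingSolver as ℕSolver using ()
open import Data.Nat.Divisibility using (divides)
open import Data.Nat.Primality
  using (Prime; prime?; prime[2]; ¬prime[0]; ¬prime[1]; prime⇒nonZero; prime⇒irreducible)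
open import Data.Sum using (_⊎_; inj₁; inj₂)
open import Data.Unit using (tt)
open import Relation.Nullary using (¬_)
open import Relation.Nullary.Decidable using (toWitness)
open import Relation.Binary.PropositionalEquality
  using (refl; sym; trans; cong; cong₂; subst; module ≡-Reasoning)

norm : ℤ[i] → ℕ
norm (a +i b) = ∣ a ∣ ℕ.* ∣ a ∣ ℕ.+ ∣ b ∣ ℕ.* ∣ b ∣

square≡∣∣² : ∀ i → i ℤ.* i ≡ + (∣ i ∣ ℕ.* ∣ i ∣)
square≡∣∣² (+ n)    = ℤP.+◃n≡+n (n ℕ.* n)
square≡∣∣² -[1+ n ] = ℤP.+◃n≡+n (suc n ℕ.* suc n)

norm-as-ℤ : ∀ a b → a ℤ.* a ℤ.+ b ℤ.* b ≡ + norm (a +i b)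
norm-as-ℤ a b = cong₂ ℤ._+_ (square≡∣∣² a) (square≡∣∣² b)

two-squares : ∀ a b c d →
  (a ℤ.* c ℤ.- b ℤ.* d) ℤ.* (a ℤ.* c ℤ.- b ℤ.* d) ℤ.+ (a ℤ.* d ℤ.+ b ℤ.* c) ℤ.* (a ℤ.* d ℤ.+ b ℤ.* c)
  ≡ (a ℤ.* a ℤ.+ b ℤ.* b) ℤ.* (c ℤ.* c ℤ.+ d ℤ.* d)
two-squares = ℤSolver.solve-∀

norm-⊗ : ∀ x y → norm (x ⊗ y) ≡ norm x ℕ.* norm y
norm-⊗ (a +i b) (c +i d) = ℤP.+-injective (begin
  + norm ((a +i b) ⊗ (c +i d))               ≡⟨ norm-as-ℤ (a ℤ.* c ℤ.- b ℤ.* d) (a ℤ.* d ℤ.+ b ℤ.* c) ⟨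
  (a ℤ.* c ℤ.- b ℤ.* d) ℤ.* (a ℤ.* c ℤ.- b ℤ.* d) ℤ.+ (a ℤ.* d ℤ.+ b ℤ.* c) ℤ.* (a ℤ.* d ℤ.+ b ℤ.* c)
                                             ≡⟨ two-squares a b c d ⟩
  (a ℤ.* a ℤ.+ b ℤ.* b) ℤ.* (c ℤ.* c ℤ.+ d ℤ.* d)
                                             ≡⟨ cong₂ ℤ._*_ (norm-as-ℤ a b) (norm-as-ℤ c d) ⟩
  + norm (a +i b) ℤ.* + norm (c +i d)        ≡⟨ ℤP.pos-* (norm (a +i b)) (norm (c +i d)) ⟨
  + (norm (a +i b) ℕ.* norm (c +i d))        ∎)
  where open ≡-Reasoning

-- Units have norm 1, since N(u) N(u⁻¹) = N(1) = 1.
unit⇒norm≡1 : ∀ u → IsUnit u → norm u ≡ 1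
unit⇒norm≡1 u (w , uw≡1) =
  ℕP.m*n≡1⇒m≡1 (norm u) (norm w) (trans (sym (norm-⊗ u w)) (cong norm uw≡1))

-- Conversely an element of norm 1 is a unit: its conjugate is its inverse.
norm≡1⇒unit : ∀ u → norm u ≡ 1 → IsUnit u
norm≡1⇒unit (a +i b) N≡1 =
  (a +i (- b)) , cong₂ _+i_ (trans (real-part a b) (trans (norm-as-ℤ a b) (cong +_ N≡1)))
                            (imaginary-part a b)
  where
  real-part : ∀ a b → a ℤ.* a ℤ.- b ℤ.* (- b) ≡ a ℤ.* a ℤ.+ b ℤ.* b
  real-part = ℤSolver.solve-∀
  imaginary-part : ∀ a b → a ℤ.* (- b) ℤ.+ b ℤ.* a ≡ + 0
  imaginary-part = ℤSolver.solve-∀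

-- A Gaussian integer whose norm is a rational prime is a Gaussian prime:
-- in a factorisation p = x y one of N(x), N(y) must be 1.
prime-norm⇒gaussianPrime : ∀ {p} → Prime (norm p) → IsGaussianPrime p
prime-norm⇒gaussianPrime {p} prime-Np = nonzero , nonunit , irreducible
  where
  nonzero : ¬ (p ≡ 0ᵍ)
  nonzero p≡0 = ¬prime[0] (subst Prime (cong norm p≡0) prime-Np)
  nonunit : ¬ IsUnit p
  nonunit u = ¬prime[1] (subst Prime (unit⇒norm≡1 p u) prime-Np)
  irreducible : ∀ x y → p ≡ x ⊗ y → IsUnit x ⊎ IsUnit y
  irreducible x y p≡xy with prime⇒irreducible prime-Np (divides (norm y) Np≡NyNx)
    where
    Np≡NyNx : norm p ≡ norm y ℕ.* norm x
    Np≡NyNx = trans (cong norm p≡xy) (trans (norm-⊗ x y) (ℕP.*-comm (norm x) (norm y)))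
  ... | inj₁ Nx≡1  = inj₁ (norm≡1⇒unit x Nx≡1)
  ... | inj₂ Nx≡Np = inj₂ (norm≡1⇒unit y (ℕP.*-cancelˡ-≡ (norm y) 1 (norm p) {{prime⇒nonZero prime-Np}}
    (begin
      norm p ℕ.* norm y  ≡⟨ cong (ℕ._* norm y) Nx≡Np ⟨
      norm x ℕ.* norm y  ≡⟨ norm-⊗ x y ⟨
      norm (x ⊗ y)       ≡⟨ cong norm p≡xy ⟨
      norm p             ≡⟨ ℕP.*-identityʳ (norm p) ⟨
      norm p ℕ.* 1       ∎)))
    where open ≡-Reasoning

positive⇒inQ : ∀ x y → InQ ((+ suc x) +i (+ suc y))
positive⇒inQ x y = +<+ (s≤s z≤n) , +<+ (s≤s z≤n)

prime[5] : Prime 5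
prime[5] = toWitness {a? = prime? 5} tt

1+i-inQ : QPrime ((+ 1) +i (+ 1))
1+i-inQ = prime-norm⇒gaussianPrime prime[2] , positive⇒inQ 0 0

2+i-inQ : QPrime ((+ 2) +i (+ 1))
2+i-inQ = prime-norm⇒gaussianPrime prime[5] , positive⇒inQ 1 0

1+2i-inQ : QPrime ((+ 1) +i (+ 2))
1+2i-inQ = prime-norm⇒gaussianPrime prime[5] , positive⇒inQ 0 1

ThreeQPrimes : ℤ[i] → Set
ThreeQPrimes z = ∃[ p ] ∃[ q ] ∃[ r ] (QPrime p × QPrime q × QPrime r × z ≡ p ⊕ q ⊕ r)

⊕-assoc : ∀ x y z → x ⊕ (y ⊕ z) ≡ x ⊕ y ⊕ z
⊕-assoc (a +i b) (c +i d) (e +i f) = sym (cong₂ _+i_ (ℤP.+-assoc a c e) (ℤP.+-assoc b d f))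

even-ℕ⇒isEven : ∀ x y k → x ℕ.+ y ≡ k ℕ.+ k → IsEven ((+ x) +i (+ y))
even-ℕ⇒isEven x y k x+y≡k+k = + k , (begin
  + (x ℕ.+ y)        ≡⟨ cong +_ x+y≡k+k ⟩
  + (k ℕ.+ k)        ≡⟨ cong (λ t → + (k ℕ.+ t)) (ℕP.+-identityʳ k) ⟨
  + (2 ℕ.* k)        ≡⟨ ℤP.pos-* 2 k ⟩
  + 2 ℤ.* + k        ∎)
  where open ≡-Reasoning

add-two-even : ∀ n m k → n ℕ.+ m ≡ k ℕ.+ k → IsEven ((+ (2 ℕ.+ n)) +i (+ (2 ℕ.+ m)))
add-two-even n m k n+m≡k+k = even-ℕ⇒isEven (2 ℕ.+ n) (2 ℕ.+ m) (2 ℕ.+ k) (begin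
  (2 ℕ.+ n) ℕ.+ (2 ℕ.+ m)  ≡⟨ regroup n m ⟩
  4 ℕ.+ (n ℕ.+ m)          ≡⟨ cong (4 ℕ.+_) n+m≡k+k ⟩
  4 ℕ.+ (k ℕ.+ k)          ≡⟨ regroup k k ⟨
  (2 ℕ.+ k) ℕ.+ (2 ℕ.+ k)  ∎)
  where
  open ≡-Reasoning
  regroup : ∀ n m → (2 ℕ.+ n) ℕ.+ (2 ℕ.+ m) ≡ 4 ℕ.+ (n ℕ.+ m)
  regroup = ℕSolver.solve-∀

goldbach-plus-prime : GaussianGoldbach → ∀ {c} → QPrime c →
  ∀ n m k → n ℕ.+ m ≡ k ℕ.+ k → ThreeQPrimes (c ⊕ ((+ (2 ℕ.+ n)) +i (+ (2 ℕ.+ m))))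
goldbach-plus-prime goldbach {c} c-inQ n m k n+m≡k+k
  with goldbach (+ (2 ℕ.+ n)) (+ (2 ℕ.+ m)) (+<+ (s≤s (s≤s z≤n))) (+<+ (s≤s (s≤s z≤n)))
                (add-two-even n m k n+m≡k+k)
... | q , r , q-inQ , r-inQ , z≡q+r =
  c , q , r , c-inQ , q-inQ , r-inQ , trans (cong (c ⊕_) z≡q+r) (⊕-assoc c q r)

even-or-odd : ∀ n → ∃[ k ] (n ≡ k ℕ.+ k ⊎ n ≡ suc (k ℕ.+ k))
even-or-odd zero = 0 , inj₁ refl
even-or-odd (suc n) with even-or-odd n
... | k , inj₁ n≡k+k = k , inj₂ (cong suc n≡k+k)
... | k , inj₂ n≡1+k+k = suc k , inj₁ (cong suc (trans n≡1+k+k (sym (ℕP.+-suc k k))))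

three-primes-ℕ : GaussianGoldbach → ∀ n m → ThreeQPrimes ((+ (3 ℕ.+ n)) +i (+ (3 ℕ.+ m)))
three-primes-ℕ goldbach n m with even-or-odd (n ℕ.+ m)
... | k , inj₁ n+m≡k+k = goldbach-plus-prime goldbach 1+i-inQ n m k n+m≡k+k
three-primes-ℕ goldbach (suc n) m | k , inj₂ 1+n+m≡1+k+k =
  goldbach-plus-prime goldbach 2+i-inQ n m k (ℕP.suc-injective 1+n+m≡1+k+k)
three-primes-ℕ goldbach zero (suc m) | k , inj₂ 1+m≡1+k+k =
  goldbach-plus-prime goldbach 1+2i-inQ 0 m k (ℕP.suc-injective 1+m≡1+k+k)
three-primes-ℕ goldbach zero zero | k , inj₂ ()

above-two : ∀ {a} → a > + 2 → ∃[ n ] (a ≡ + (3 ℕ.+ n))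
above-two {+ suc (suc (suc n))} _ = n , refl
above-two {+ 0} (+<+ ())
above-two {+ 1} (+<+ (s≤s ()))
above-two {+ 2} (+<+ (s≤s (s≤s ())))
above-two { -[1+ n ]} ()

mainTheorem5 : GaussianGoldbach →
    ∀ (a b : ℤ) → a > + 2 → b > + 2 →
    ∃[ p ] ∃[ q ] ∃[ r ] (QPrime p × QPrime q × QPrime r × (a +i b) ≡ p ⊕ q ⊕ r)
mainTheorem5 goldbach a b a>2 b>2 with above-two a>2 | above-two b>2
... | n , refl | m , refl = three-primes-ℕ goldbach n m
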